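{- Let $q$ be a prime power and let $L\subseteq\{0,1,\ldots,q-1\}$ with $|L|=s$. Let $\mathcal{F}\subseteq 2^{[n]}$ be a $q$-modular $L$-avoiding $L$-intersecting system. Then $$|\mathcal{F}|\le\sum_{i=0}^{q-1}\binom{n}{i}.$$
   Context: $[n]=\{1,\ldots,n\}$, $2^{[n]}$ is the family of all subsets of $[n]$. $\mathcal{F}$ is $q$-modular $L$-intersecting if for all distinct $A,B\in\mathcal{F}$, $|A\cap B|\equiv\ell\pmod q$ for some $\ell\in L$, and $q$-modular $L$-avoiding if for every $A\in\mathcal{F}$, $|A|\not\equiv\ell\pmod q$ for all $\ell\in L$. -}

module Defs where

open import Data.Nat using (ℕ; _≡ᵇ_; _^_; _≥_; _<_; _+_; NonZero)
open import Data.Nat.DivMod using (_%_)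
open import Data.Nat.Primality using (Prime)
open import Data.Nat.Combinatorics using (_C_)
open import Data.Fin.Subset using (Subset; ∣_∣; _∩_)
open import Data.List using (List; map; upTo)
open import Data.Nat.ListAction using (sum)
open import Data.List.Membership.Propositional using (_∈_)
open import Data.List.Relation.Unary.Any using (Any)
open import Data.List.Relation.Unary.All using (All)
open import Data.Product using (Σ; ∃; _×_)
open import Relation.Binary.PropositionalEquality using (_≡_; _≢_)
open import Relation.Nullary using (¬_)

IsPrimePower : ℕ → Set
IsPrimePower q = ∃ λ p → ∃ λ k → Prime p × k ≥ 1 × q ≡ p ^ k

ModEq : (q : ℕ) → .{{NonZero q}} → ℕ → ℕ → Set
ModEq q a b = a % q ≡ b % q

ModLIntersecting : {n : ℕ} (q : ℕ) → .{{NonZero q}} → List ℕ → List (Subset n) → Set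
ModLIntersecting {n} q L F =
  ∀ (A B : Subset n) → A ∈ F → B ∈ F → A ≢ B → Any (λ ℓ → ModEq q ∣ A ∩ B ∣ ℓ) L

ModLAvoiding : {n : ℕ} (q : ℕ) → .{{NonZero q}} → List ℕ → List (Subset n) → Set
ModLAvoiding {n} q L F =
  ∀ (A : Subset n) → A ∈ F → All (λ ℓ → ¬ ModEq q ∣ A ∣ ℓ) L

binomSumBelow : ℕ → ℕ → ℕ
binomSumBelow n q = sum (map (λ i → n C i) (upTo q))

-- Polynomial method modulo p, where q = p^k.  With Q = q·p^n, a power of p larger than n,
-- attach to each A ∈ F the polynomial f_A(x) = C(∑_{i ∈ A} x_i + Q − 1 − |A|, q − 1).  After
-- multilinear reduction it lies in the span of the Σ_{i<q} C(n,i) monomials x^t with |t| < q,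
-- and by Vandermonde f_A(1_B) = C(|A ∩ B| + Q − 1 − |A|, q − 1).  On the diagonal this is
-- C(Q − 1, q − 1), which p does not divide; for A ≠ B in F the upper argument plus one is
-- ≡ |A ∩ B| − |A| ≢ 0 (mod q), and (m + 1)·C(m, q − 1) = q·C(m + 1, q) then forces p to divide
-- it.  So a linear relation mod p among the coefficient vectors of the f_A, evaluated at 1_B
-- for B ∈ F, has every coefficient divisible by p: the vectors are independent mod p, and F
-- has at most as many members as there are monomials.
{-# OPTIONS --safe #-}
module Submission where

open import Defs
open import Data.Nat using (ℕ; _<_; _≤_; NonZero)
open import Data.Fin.Subset using (Subset)
open import Data.List using (List; length)
open import Data.List.Relation.Unary.All using (All)
open import Data.List.Relation.Unary.Unique.Propositional using (Unique)

module ListSum where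
  open import Data.Nat
  open import Data.Nat.Properties
  open import Data.List using (List; []; _∷_; _++_; map; concat; length)
  open import Data.List.Properties using (length-++)
  open import Data.List.Relation.Unary.All using (All; []; _∷_)
  open import Data.Nat.ListAction using (sum)
  open import Function using (_∘_)
  open import Relation.Binary.PropositionalEquality

  sumMap : {A : Set} → (A → ℕ) → List A → ℕ
  sumMap f xs = sum (map f xs)

  module _ {A : Set} where

    sumMap-++ : ∀ (f : A → ℕ) xs ys → sumMap f (xs ++ ys) ≡ sumMap f xs + sumMap f ys
    sumMap-++ f []       ys = refl
    sumMap-++ f (x ∷ xs) ys = trans (cong (f x +_) (sumMap-++ f xs ys)) (sym (+-assoc (f x) _ _))

    sumMap-map : ∀ {B : Set} (f : B → ℕ) (g : A → B) xs → sumMap f (map g xs) ≡ sumMap (λ x → f (g x)) xs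
    sumMap-map f g []       = refl
    sumMap-map f g (x ∷ xs) = cong (f (g x) +_) (sumMap-map f g xs)

    sumMap-concat : ∀ {B : Set} (f : A → ℕ) (g : B → List A) xs →
                    sumMap f (concat (map g xs)) ≡ sumMap (λ y → sumMap f (g y)) xs
    sumMap-concat f g []       = refl
    sumMap-concat f g (y ∷ ys) = trans (sumMap-++ f (g y) _) (cong (sumMap f (g y) +_) (sumMap-concat f g ys))

    sumMap-cong : ∀ {f g : A → ℕ} xs → (∀ x → f x ≡ g x) → sumMap f xs ≡ sumMap g xs
    sumMap-cong []       f≗g = refl
    sumMap-cong (x ∷ xs) f≗g = cong₂ _+_ (f≗g x) (sumMap-cong xs f≗g)

    sumMap-congᴬ : ∀ {P : A → Set} {f g : A → ℕ} {xs} → All P xs → (∀ {x} → P x → f x ≡ g x) →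
                   sumMap f xs ≡ sumMap g xs
    sumMap-congᴬ []         f≗g = refl
    sumMap-congᴬ (px ∷ pxs) f≗g = cong₂ _+_ (f≗g px) (sumMap-congᴬ pxs f≗g)

    sumMap-zero : ∀ {f : A → ℕ} xs → (∀ x → f x ≡ 0) → sumMap f xs ≡ 0
    sumMap-zero []       f≗0 = refl
    sumMap-zero (x ∷ xs) f≗0 = cong₂ _+_ (f≗0 x) (sumMap-zero xs f≗0)

    sumMap-*ˡ : ∀ c (f : A → ℕ) xs → sumMap (λ x → c * f x) xs ≡ c * sumMap f xs
    sumMap-*ˡ c f []       = sym (*-zeroʳ c)
    sumMap-*ˡ c f (x ∷ xs) = trans (cong (c * f x +_) (sumMap-*ˡ c f xs)) (sym (*-distribˡ-+ c (f x) _))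

  length-concat-map : ∀ {A B : Set} (f : B → List A) xs → length (concat (map f xs)) ≡ sumMap (length ∘ f) xs
  length-concat-map f []       = refl
  length-concat-map f (x ∷ xs) = trans (length-++ (f x)) (cong (length (f x) +_) (length-concat-map f xs))

module Binomial where
  open ListSum
  open import Data.Nat
  open import Data.Nat.Properties
  open import Data.Nat.Combinatorics using (_C_; nCk+nC[k+1]≡[n+1]C[k+1])
  open import Data.Nat.Divisibility
  open import Data.Nat.Primality
  open import Data.Nat.Solver using (module +-*-Solver)
  open import Data.List using (map; upTo; applyUpTo)
  open import Data.List.Properties using (map-upTo)
  open import Data.Sum using (inj₁; inj₂)
  open import Data.Empty using (⊥-elim)
  open import Function using (_∘_)
  open import Relation.Nullary using (¬_; yes; no)
  open import Relation.Binary.PropositionalEquality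
  open +-*-Solver

  -- `_C_` is computed through factorials and does not unfold by Pascal's rule.
  choose : ℕ → ℕ → ℕ
  choose n       zero    = 1
  choose zero    (suc k) = 0
  choose (suc n) (suc k) = choose n k + choose n (suc k)

  choose≡C : ∀ n k → choose n k ≡ n C k
  choose≡C n       zero    = refl
  choose≡C zero    (suc k) = refl
  choose≡C (suc n) (suc k) =
    trans (cong₂ _+_ (choose≡C n k) (choose≡C n (suc k))) (nCk+nC[k+1]≡[n+1]C[k+1] n k)

  choose-1 : ∀ n → choose n 1 ≡ n
  choose-1 zero    = refl
  choose-1 (suc n) = cong suc (choose-1 n)

  suc-*-choose : ∀ m k → suc m * choose m k ≡ suc k * choose (suc m) (suc k)
  suc-*-choose zero    zero    = refl
  suc-*-choose zero    (suc k) = sym (*-zeroʳ (2 + k))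
  suc-*-choose (suc m) zero    =
    cong suc (trans (*-identityʳ (suc m)) (sym (trans (+-identityʳ _) (cong suc (choose-1 m)))))
  suc-*-choose (suc m) (suc k) = begin
    suc (suc m) * choose (suc m) (suc k)                   ≡⟨ cong (X +_) (*-distribˡ-+ (suc m) (choose m k) _) ⟩
    X + (suc m * choose m k + suc m * choose m (suc k))    ≡⟨ cong₂ (λ u v → X + (u + v)) (suc-*-choose m k) (suc-*-choose m (suc k)) ⟩
    X + (suc k * X + suc (suc k) * Y)                      ≡⟨ solve 3 (λ k X Y → X :+ ((con 1 :+ k) :* X :+ (con 2 :+ k) :* Y)
                                                                             := (con 2 :+ k) :* (X :+ Y)) refl k X Y ⟩
    suc (suc k) * (X + Y)                                  ∎
    where
    open ≡-Reasoning
    X = choose (suc m) (suc k)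
    Y = choose (suc m) (suc (suc k))

  convolution : (ℕ → ℕ) → (ℕ → ℕ) → ℕ → ℕ
  convolution f g zero    = f 0 * g 0
  convolution f g (suc d) = f 0 * g (suc d) + convolution (f ∘ suc) g d

  convolution-+ : ∀ f f′ g d → convolution (λ j → f j + f′ j) g d ≡ convolution f g d + convolution f′ g d
  convolution-+ f f′ g zero    = *-distribʳ-+ (g 0) (f 0) (f′ 0)
  convolution-+ f f′ g (suc d) = begin
    (f 0 + f′ 0) * g (suc d) + convolution (λ j → f (suc j) + f′ (suc j)) g d
      ≡⟨ cong₂ _+_ (*-distribʳ-+ (g (suc d)) (f 0) (f′ 0)) (convolution-+ (f ∘ suc) (f′ ∘ suc) g d) ⟩
    (a + b) + (c + e)
      ≡⟨ solve 4 (λ a b c e → (a :+ b) :+ (c :+ e) := (a :+ c) :+ (b :+ e)) refl a b c e ⟩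
    (a + c) + (b + e) ∎
    where
    open ≡-Reasoning
    a = f 0 * g (suc d)
    b = f′ 0 * g (suc d)
    c = convolution (f ∘ suc) g d
    e = convolution (f′ ∘ suc) g d

  convolution-zeroˡ : ∀ f g d → (∀ j → f j ≡ 0) → convolution f g d ≡ 0
  convolution-zeroˡ f g zero    f≡0 rewrite f≡0 0 = refl
  convolution-zeroˡ f g (suc d) f≡0 rewrite f≡0 0 = convolution-zeroˡ (f ∘ suc) g d (f≡0 ∘ suc)

  convolution-upTo : ∀ f g d → sumMap (λ j → f j * g (d ∸ j)) (upTo (suc d)) ≡ convolution f g d
  convolution-upTo f g zero    = +-identityʳ _
  convolution-upTo f g (suc d) = cong (f 0 * g (suc d) +_) (begin
    sumMap h (applyUpTo suc (suc d))                  ≡⟨ cong (sumMap h) (map-upTo suc (suc d)) ⟨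
    sumMap h (map suc (upTo (suc d)))                 ≡⟨ sumMap-map h suc (upTo (suc d)) ⟩
    sumMap (λ j → f (suc j) * g (d ∸ j)) (upTo (suc d)) ≡⟨ convolution-upTo (f ∘ suc) g d ⟩
    convolution (f ∘ suc) g d                         ∎)
    where
    open ≡-Reasoning
    h = λ j → f j * g (suc d ∸ j)

  vandermonde : ∀ m n d → convolution (choose m) (choose n) d ≡ choose (m + n) d
  vandermonde zero    n zero    = refl
  vandermonde zero    n (suc d) =
    trans (cong₂ _+_ (+-identityʳ _) (convolution-zeroˡ _ (choose n) d (λ _ → refl))) (+-identityʳ _)
  vandermonde (suc m) n zero    = refl
  vandermonde (suc m) n (suc d) = begin
    1 * choose n (suc d) + convolution (λ j → choose m j + choose m (suc j)) (choose n) d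
      ≡⟨ cong (u +_) (convolution-+ (choose m) (choose m ∘ suc) (choose n) d) ⟩
    u + (v + w)
      ≡⟨ solve 3 (λ u v w → u :+ (v :+ w) := v :+ (u :+ w)) refl u v w ⟩
    convolution (choose m) (choose n) d + convolution (choose m) (choose n) (suc d)
      ≡⟨ cong₂ _+_ (vandermonde m n d) (vandermonde m n (suc d)) ⟩
    choose (m + n) d + choose (m + n) (suc d) ∎
    where
    open ≡-Reasoning
    u = 1 * choose n (suc d)
    v = convolution (choose m) (choose n) d
    w = convolution (choose m ∘ suc) (choose n) d

  module _ {p : ℕ} (p-prime : Prime p) where

    private instance
      p≢0 : NonZero p
      p≢0 = prime⇒nonZero p-prime

    p∤1 : ¬ p ∣ 1
    p∤1 p∣1 = <-irrefl (sym (∣1⇒≡1 p∣1)) (nonTrivial⇒n>1 p {{prime⇒nonTrivial p-prime}})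

    p^r∣m*n⇒p∤n⇒p^r∣m : ∀ r m n → p ^ r ∣ m * n → ¬ p ∣ n → p ^ r ∣ m
    p^r∣m*n⇒p∤n⇒p^r∣m zero    m n _ _ = 1∣ m
    p^r∣m*n⇒p∤n⇒p^r∣m (suc r) m n p^r∣mn p∤n
      with euclidsLemma m n p-prime (∣-trans (m∣m*n (p ^ r)) p^r∣mn)
    ... | inj₂ p∣n = ⊥-elim (p∤n p∣n)
    ... | inj₁ (divides m′ refl) =
      subst (p * p ^ r ∣_) (*-comm p m′) (*-monoʳ-∣ p (p^r∣m*n⇒p∤n⇒p^r∣m r m′ n p^r∣m′n p∤n))
      where
      p^r∣m′n : p ^ r ∣ m′ * n
      p^r∣m′n = *-cancelˡ-∣ p (subst (p * p ^ r ∣_) (solve 3 (λ m p n → m :* p :* n := p :* (m :* n)) refl m′ p n) p^r∣mn)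

    p^r∣m*n⇒p^r∤m⇒p∣n : ∀ r m n → p ^ r ∣ m * n → ¬ p ^ r ∣ m → p ∣ n
    p^r∣m*n⇒p^r∤m⇒p∣n r m n p^r∣mn p^r∤m with p ∣? n
    ... | yes p∣n = p∣n
    ... | no  p∤n = ⊥-elim (p^r∤m (p^r∣m*n⇒p∤n⇒p^r∣m r m n p^r∣mn p∤n))

    p∤choose[p^r-1] : ∀ r {m} → suc m ≡ p ^ r → ∀ j → j ≤ m → ¬ p ∣ choose m j
    p∤choose[p^r-1] _ _       zero    _   = p∤1
    p∤choose[p^r-1] r {m} 1+m≡p^r (suc j) j<m p∣mCj+1 =
      p∤choose[p^r-1] r 1+m≡p^r j (<⇒≤ j<m) (∣m+n∣m⇒∣n (subst (p ∣_) (+-comm (choose m j) _) p∣[m+1]C[j+1]) p∣mCj+1)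
      where
      p^r∣[j+1]*[m+1]C[j+1] : p ^ r ∣ suc j * choose (suc m) (suc j)
      p^r∣[j+1]*[m+1]C[j+1] = subst₂ _∣_ 1+m≡p^r (suc-*-choose m j) (m∣m*n (choose m j))
      p^r∤j+1 : ¬ p ^ r ∣ suc j
      p^r∤j+1 p^r∣j+1 = <-irrefl refl (<-≤-trans (s≤s j<m) (∣⇒≤ (subst (_∣ suc j) (sym 1+m≡p^r) p^r∣j+1)))
      p∣[m+1]C[j+1] : p ∣ choose (suc m) (suc j)
      p∣[m+1]C[j+1] = p^r∣m*n⇒p^r∤m⇒p∣n r (suc j) _ p^r∣[j+1]*[m+1]C[j+1] p^r∤j+1

    p∣choose[m][p^k-1] : ∀ k {q} → suc q ≡ p ^ k → ∀ m → ¬ suc q ∣ suc m → p ∣ choose m q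
    p∣choose[m][p^k-1] k {q} 1+q≡p^k m q+1∤m+1 =
      p^r∣m*n⇒p^r∤m⇒p∣n k (suc m) (choose m q)
        (subst₂ _∣_ 1+q≡p^k (sym (suc-*-choose m q)) (m∣m*n (choose (suc m) (suc q))))
        (q+1∤m+1 ∘ subst (_∣ suc m) (sym 1+q≡p^k))

module SubsetMonomials where
  open import Data.Nat
  open import Data.Nat.Properties
  open import Data.Bool using (true; false)
  open import Data.Vec using ([]; _∷_)
  open import Data.Fin.Subset using (Subset; ∣_∣; _∩_)
  open import Data.List using (List; []; _∷_; _++_; map; length)
  open import Data.List.Properties using (length-++; length-map)
  open import Data.List.Relation.Unary.All using (All; []; _∷_)
  import Data.List.Relation.Unary.All as All
  open import Data.List.Relation.Unary.All.Properties using (map⁺; ++⁺)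
  open import Relation.Binary.PropositionalEquality
  open ListSum
  open Binomial using (choose)

  -- The monomial x^t = ∏_{i ∈ t} x_i evaluated at the characteristic vector of B.
  [_⊆_] : ∀ {n} → Subset n → Subset n → ℕ
  [ []        ⊆ []        ] = 1
  [ false ∷ t ⊆ _     ∷ B ] = [ t ⊆ B ]
  [ true  ∷ t ⊆ true  ∷ B ] = [ t ⊆ B ]
  [ true  ∷ t ⊆ false ∷ B ] = 0

  [⊆]-*-∩ : ∀ {n} (t A B : Subset n) → [ t ⊆ A ] * [ t ⊆ B ] ≡ [ t ⊆ A ∩ B ]
  [⊆]-*-∩ []          []          []          = refl
  [⊆]-*-∩ (false ∷ t) (_ ∷ A)     (_ ∷ B)     = [⊆]-*-∩ t A B
  [⊆]-*-∩ (true ∷ t)  (false ∷ A) (_ ∷ B)     = refl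
  [⊆]-*-∩ (true ∷ t)  (true ∷ A)  (false ∷ B) = *-zeroʳ [ t ⊆ A ]
  [⊆]-*-∩ (true ∷ t)  (true ∷ A)  (true ∷ B)  = [⊆]-*-∩ t A B

  subsetsOfSize : ∀ n → ℕ → List (Subset n)
  subsetsOfSize zero    zero    = [] ∷ []
  subsetsOfSize zero    (suc j) = []
  subsetsOfSize (suc n) zero    = map (false ∷_) (subsetsOfSize n zero)
  subsetsOfSize (suc n) (suc j) = map (false ∷_) (subsetsOfSize n (suc j)) ++ map (true ∷_) (subsetsOfSize n j)

  length-subsetsOfSize : ∀ n j → length (subsetsOfSize n j) ≡ choose n j
  length-subsetsOfSize zero    zero    = refl
  length-subsetsOfSize zero    (suc j) = refl
  length-subsetsOfSize (suc n) zero    = trans (length-map _ (subsetsOfSize n zero)) (length-subsetsOfSize n zero)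
  length-subsetsOfSize (suc n) (suc j) = begin
    length (map (false ∷_) S₀ ++ map (true ∷_) S₁)               ≡⟨ length-++ (map (false ∷_) S₀) ⟩
    length (map (false ∷_) S₀) + length (map (true ∷_) S₁)       ≡⟨ cong₂ _+_ (length-map _ S₀) (length-map _ S₁) ⟩
    length S₀ + length S₁                                        ≡⟨ cong₂ _+_ (length-subsetsOfSize n (suc j)) (length-subsetsOfSize n j) ⟩
    choose n (suc j) + choose n j                                ≡⟨ +-comm (choose n (suc j)) _ ⟩
    choose n j + choose n (suc j)                                ∎
    where
    open ≡-Reasoning
    S₀ = subsetsOfSize n (suc j)
    S₁ = subsetsOfSize n j

  ∣∣-subsetsOfSize : ∀ n j → All (λ t → ∣ t ∣ ≡ j) (subsetsOfSize n j)
  ∣∣-subsetsOfSize zero    zero    = refl ∷ []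
  ∣∣-subsetsOfSize zero    (suc j) = []
  ∣∣-subsetsOfSize (suc n) zero    = map⁺ (∣∣-subsetsOfSize n zero)
  ∣∣-subsetsOfSize (suc n) (suc j) =
    ++⁺ (map⁺ (∣∣-subsetsOfSize n (suc j))) (map⁺ (All.map (cong suc) (∣∣-subsetsOfSize n j)))

  sumMap-[⊆]-subsetsOfSize : ∀ n j (X : Subset n) → sumMap [_⊆ X ] (subsetsOfSize n j) ≡ choose (∣ X ∣) j
  sumMap-[⊆]-subsetsOfSize zero    zero    []      = refl
  sumMap-[⊆]-subsetsOfSize zero    (suc j) []      = refl
  sumMap-[⊆]-subsetsOfSize (suc n) zero    (x ∷ X) =
    trans (sumMap-map [_⊆ x ∷ X ] _ (subsetsOfSize n zero)) (sumMap-[⊆]-subsetsOfSize n zero X)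
  sumMap-[⊆]-subsetsOfSize (suc n) (suc j) (x ∷ X) = begin
    sumMap [_⊆ x ∷ X ] (map (false ∷_) S₀ ++ map (true ∷_) S₁)
      ≡⟨ sumMap-++ [_⊆ x ∷ X ] (map (false ∷_) S₀) _ ⟩
    sumMap [_⊆ x ∷ X ] (map (false ∷_) S₀) + sumMap [_⊆ x ∷ X ] (map (true ∷_) S₁)
      ≡⟨ cong₂ _+_ (sumMap-map [_⊆ x ∷ X ] _ S₀) (sumMap-map [_⊆ x ∷ X ] _ S₁) ⟩
    sumMap [_⊆ X ] S₀ + sumMap (λ t → [ true ∷ t ⊆ x ∷ X ]) S₁
      ≡⟨ cong (_+ sumMap (λ t → [ true ∷ t ⊆ x ∷ X ]) S₁) (sumMap-[⊆]-subsetsOfSize n (suc j) X) ⟩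
    choose (∣ X ∣) (suc j) + sumMap (λ t → [ true ∷ t ⊆ x ∷ X ]) S₁
      ≡⟨ pascal x ⟩
    choose (∣ x ∷ X ∣) (suc j) ∎
    where
    open ≡-Reasoning
    S₀ = subsetsOfSize n (suc j)
    S₁ = subsetsOfSize n j
    pascal : ∀ x → choose (∣ X ∣) (suc j) + sumMap (λ t → [ true ∷ t ⊆ x ∷ X ]) S₁ ≡ choose (∣ x ∷ X ∣) (suc j)
    pascal false = trans (cong (choose (∣ X ∣) (suc j) +_) (sumMap-zero S₁ (λ _ → refl))) (+-identityʳ _)
    pascal true  = trans (cong (choose (∣ X ∣) (suc j) +_) (sumMap-[⊆]-subsetsOfSize n j X)) (+-comm (choose (∣ X ∣) (suc j)) _)

module LinearDependence where
  open import Data.Nat as ℕ using (ℕ; zero; suc; s≤s)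
  import Data.Nat.Properties as ℕ
  import Data.Nat.Divisibility as ℕ
  open import Data.Nat.Primality using (Prime; euclidsLemma)
  open import Data.Integer using (ℤ; +_; _+_; _*_; -_) renaming (∣_∣ to abs)
  import Data.Integer.Properties as ℤ
  open import Data.Integer.Divisibility.Signed
  open import Data.Integer.Solver using (module +-*-Solver)
  open import Algebra.Properties.Semiring.Sum ℤ.+-*-semiring
    using (sum; sum-remove; sum-cong-≗; ∑-distrib-+; *-distribʳ-sum)
  open import Data.Fin using (Fin; zero; suc; punchIn)
  open import Data.Fin.Properties using (punchInᵢ≢i; all?; ¬∀⟶∃¬)
  open import Data.Vec.Functional using (insertAt)
  open import Data.Vec.Functional.Properties using (insertAt-lookup; insertAt-punchIn)
  open import Data.List using (List; []; _∷_; length)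
  open import Data.List.Relation.Unary.All using (All; []; _∷_)
  import Data.List.Relation.Unary.All as All
  open import Data.Product using (∃; _,_; proj₁; proj₂)
  open import Data.Sum using (_⊎_; inj₁; inj₂; [_,_]′)
  open import Function using (_∘_)
  open import Relation.Nullary using (¬_; yes; no)
  open import Relation.Binary.PropositionalEquality
  open +-*-Solver
  open ListSum using (sumMap)

  ∣0 : ∀ {m} → m ∣ + 0
  ∣0 = divides (+ 0) refl

  ∣-sum : ∀ {m k} (f : Fin k → ℤ) → (∀ i → m ∣ f i) → m ∣ sum f
  ∣-sum {k = zero}  f m∣f = ∣0
  ∣-sum {k = suc k} f m∣f = ∣m∣n⇒∣m+n (m∣f zero) (∣-sum (f ∘ suc) (m∣f ∘ suc))

  ∣-sum⇒∣-term : ∀ {m k} (f : Fin k → ℤ) j → (∀ i → i ≢ j → m ∣ f i) → m ∣ sum f → m ∣ f j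
  ∣-sum⇒∣-term {k = suc _} f j m∣others m∣sum =
    ∣m+n∣n⇒∣m (subst (_ ∣_) (sum-remove {i = j} f) m∣sum)
               (∣-sum _ (λ i → m∣others (punchIn j i) (punchInᵢ≢i j i)))

  sum-insertAt : ∀ {k} (f : Fin k → ℤ) j e (v : Fin (suc k) → ℤ) →
                 sum (λ x → insertAt f j e x * v x) ≡ e * v j + sum (λ i → f i * v (punchIn j i))
  sum-insertAt f j e v =
    trans (sum-remove {i = j} (λ x → insertAt f j e x * v x))
          (cong₂ (λ a b → a * v j + b) (insertAt-lookup f j e)
                 (sum-cong-≗ (λ i → cong (_* v (punchIn j i)) (insertAt-punchIn f j e i))))

  ∣-sum-weighted : ∀ {m k} {I : Set} (c : Fin k → ℤ) (v : Fin k → I → ℕ) (w : I → ℕ) (T : List I) →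
                   All (λ t → m ∣ sum (λ i → c i * + v i t)) T →
                   m ∣ sum (λ i → c i * + sumMap (λ t → v i t ℕ.* w t) T)
  ∣-sum-weighted c v w []       []             = ∣-sum _ (λ i → ∣n⇒∣m*n (c i) ∣0)
  ∣-sum-weighted c v w (t ∷ T) (m∣vt ∷ m∣vT) =
    subst (_ ∣_) (sym split) (∣m∣n⇒∣m+n (∣m⇒∣m*n (+ w t) m∣vt) (∣-sum-weighted c v w T m∣vT))
    where
    rest : Fin _ → ℕ
    rest i = sumMap (λ t → v i t ℕ.* w t) T
    term : ∀ i → c i * + (v i t ℕ.* w t ℕ.+ rest i) ≡ c i * + v i t * + w t + c i * + rest i
    term i = trans (cong (c i *_) (trans (ℤ.pos-+ (v i t ℕ.* w t) (rest i)) (cong (_+ + rest i) (ℤ.pos-* (v i t) (w t)))))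
                   (solve 4 (λ c a w r → c :* (a :* w :+ r) := c :* a :* w :+ c :* r) refl (c i) (+ v i t) (+ w t) (+ rest i))
    split : sum (λ i → c i * + (v i t ℕ.* w t ℕ.+ rest i)) ≡ sum (λ i → c i * + v i t) * + w t + sum (λ i → c i * + rest i)
    split = trans (sum-cong-≗ term)
                  (trans (∑-distrib-+ (λ i → c i * + v i t * + w t) (λ i → c i * + rest i))
                         (cong (_+ sum (λ i → c i * + rest i)) (sym (*-distribʳ-sum (+ w t) (λ i → c i * + v i t)))))

  module _ {p : ℕ} (p-prime : Prime p) where

    +p∤1 : ¬ + p ∣ + 1
    +p∤1 = Binomial.p∤1 p-prime ∘ ∣⇒∣ᵤ

    +p∣m*n⇒+p∣m⊎+p∣n : ∀ m n → + p ∣ m * n → + p ∣ m ⊎ + p ∣ n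
    +p∣m*n⇒+p∣m⊎+p∣n m n p∣mn
      with euclidsLemma (abs m) (abs n) p-prime (subst (p ℕ.∣_) (ℤ.abs-* m n) (∣⇒∣ᵤ p∣mn))
    ... | inj₁ p∣m = inj₁ (∣ᵤ⇒∣ p∣m)
    ... | inj₂ p∣n = inj₂ (∣ᵤ⇒∣ p∣n)

    record DependenceMod {I : Set} {k} (v : Fin k → I → ℤ) (T : List I) : Set where
      field
        coeff      : Fin k → ℤ
        nontrivial : ∃ λ i → ¬ + p ∣ coeff i
        vanishes   : All (λ t → + p ∣ sum (λ i → coeff i * v i t)) T

    module _ {I : Set} {k : ℕ} where

      dependence-∷-zero : ∀ {v : Fin k → I → ℤ} {t T} → (∀ i → + p ∣ v i t) →
                          DependenceMod v T → DependenceMod v (t ∷ T)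
      dependence-∷-zero {t = t} p∣vt dep = record
        { coeff      = coeff
        ; nontrivial = nontrivial
        ; vanishes   = ∣-sum _ (λ i → ∣n⇒∣m*n (coeff i) (p∣vt i)) ∷ vanishes
        }
        where open DependenceMod dep

      -- Gaussian elimination of coordinate t, pivoting on the vector v j.
      eliminate : (v : Fin (suc k) → I → ℤ) → Fin (suc k) → I → Fin k → I → ℤ
      eliminate v j t i s = v j t * v (punchIn j i) s + - (v (punchIn j i) t * v j s)

      dependence-∷-pivot : ∀ {v : Fin (suc k) → I → ℤ} {t T} j → ¬ + p ∣ v j t →
                           DependenceMod (eliminate v j t) T → DependenceMod v (t ∷ T)
      dependence-∷-pivot {v} {t} {T} j p∤vjt dep = record
        { coeff      = c
        ; nontrivial = punchIn j i₀ , p∤c[punchIn-j-i₀]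
        ; vanishes   = subst (_ ∣_) (sym (lift t)) (∣-sum _ (λ i → ∣n⇒∣m*n (d i) (subst (_ ∣_) (eliminated i) ∣0)))
                     ∷ All.map (λ {s} → subst (_ ∣_) (sym (lift s))) vanishes
        }
        where
        open DependenceMod dep renaming (coeff to d)
        i₀ = proj₁ nontrivial
        a = v j t
        v′ : Fin k → I → ℤ
        v′ i = v (punchIn j i)
        e = sum (λ i → - (d i * v′ i t))
        c = insertAt (λ i → d i * a) j e
        eliminated : ∀ i → + 0 ≡ eliminate v j t i t
        eliminated i = solve 2 (λ a b → con (+ 0) := a :* b :+ :- (b :* a)) refl a (v′ i t)
        p∤c[punchIn-j-i₀] : ¬ + p ∣ c (punchIn j i₀)
        p∤c[punchIn-j-i₀] p∣c = [ proj₂ nontrivial , p∤vjt ]′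
          (+p∣m*n⇒+p∣m⊎+p∣n (d i₀) a (subst (_ ∣_) (insertAt-punchIn _ j e i₀) p∣c))
        lift : ∀ s → sum (λ x → c x * v x s) ≡ sum (λ i → d i * eliminate v j t i s)
        lift s = begin
          sum (λ x → c x * v x s)
            ≡⟨ sum-insertAt (λ i → d i * a) j e (λ x → v x s) ⟩
          e * v j s + sum (λ i → d i * a * v′ i s)
            ≡⟨ ℤ.+-comm (e * v j s) _ ⟩
          sum (λ i → d i * a * v′ i s) + e * v j s
            ≡⟨ cong (λ x → sum (λ i → d i * a * v′ i s) + x) (*-distribʳ-sum (v j s) (λ i → - (d i * v′ i t))) ⟩
          sum (λ i → d i * a * v′ i s) + sum (λ i → - (d i * v′ i t) * v j s)
            ≡⟨ ∑-distrib-+ (λ i → d i * a * v′ i s) (λ i → - (d i * v′ i t) * v j s) ⟨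
          sum (λ i → d i * a * v′ i s + - (d i * v′ i t) * v j s)
            ≡⟨ sum-cong-≗ (λ i → solve 5 (λ d a x y z → d :* a :* x :+ :- (d :* y) :* z := d :* (a :* x :+ :- (y :* z))) refl
                                          (d i) a (v′ i s) (v′ i t) (v j s)) ⟩
          sum (λ i → d i * eliminate v j t i s) ∎
          where open ≡-Reasoning

    length<⇒DependenceMod : ∀ {I : Set} {k} (T : List I) → length T ℕ.< k → (v : Fin k → I → ℤ) → DependenceMod v T
    length<⇒DependenceMod {k = suc k} [] _ v = record
      { coeff      = λ { zero → + 1 ; (suc _) → + 0 }
      ; nontrivial = zero , +p∤1
      ; vanishes   = []
      }
    length<⇒DependenceMod {k = suc k} (t ∷ T) (s≤s |T|<k) v with all? (λ i → + p ∣? v i t)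
    ... | yes p∣vt = dependence-∷-zero p∣vt (length<⇒DependenceMod T (ℕ.m<n⇒m<1+n |T|<k) v)
    ... | no ¬p∣vt with ¬∀⟶∃¬ _ _ (λ i → + p ∣? v i t) ¬p∣vt
    ...   | j , p∤vjt = dependence-∷-pivot j p∤vjt (length<⇒DependenceMod T |T|<k (eliminate v j t))

open import Data.Nat using (zero; suc; ≢-nonZero⁻¹; _+_; _*_; _∸_; _^_; pred; z≤n; s≤s; nonTrivial⇒n>1)
open import Data.Nat.Properties
open import Data.Nat.Divisibility using (_∣_; divides)
open import Data.Nat.Solver using (module +-*-Solver)
open import Data.Nat.DivMod using (_%_; %-remove-+ˡ; %-remove-+ʳ)
open import Data.Nat.Primality using (Prime; prime⇒nonZero; prime⇒nonTrivial)
import Data.Integer as ℤ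
import Data.Integer.Properties as ℤ
open import Algebra.Properties.Semiring.Sum ℤ.+-*-semiring using (sum)
open import Data.Integer.Divisibility.Signed using (∣n⇒∣m*n; ∣ᵤ⇒∣; ∣⇒∣ᵤ) renaming (_∣_ to _∣ᶻ_)
open import Data.Fin using (Fin; zero; suc)
open import Data.Fin.Subset using (∣_∣; _∩_)
open import Data.Fin.Subset.Properties using (∣p∣≤n; ∩-idem)
open import Data.List using (_∷_; lookup; concat; map; upTo)
import Data.List.Relation.Unary.All as All
open import Data.List.Relation.Unary.AllPairs using (_∷_)
open import Data.List.Membership.Propositional using (_∈_)
open import Data.List.Membership.Propositional.Properties using (∈-lookup)
open import Data.Product using (_,_; proj₁; proj₂)
open import Data.Sum using ([_,_]′)
open import Data.Empty using (⊥-elim)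
open import Function using (id; _∘_)
open import Relation.Nullary using (¬_)
open import Relation.Binary.PropositionalEquality
open +-*-Solver using (solve; _:*_; _:=_)
open ListSum
open Binomial
open SubsetMonomials
open LinearDependence

lookup-injective : ∀ {A : Set} {xs : List A} → Unique xs → ∀ {i j} → lookup xs i ≡ lookup xs j → i ≡ j
lookup-injective {xs = _ ∷ _} (_     ∷ _) {zero}  {zero}  _  = refl
lookup-injective {xs = _ ∷ _} (x∉xs ∷ _) {zero}  {suc j} eq = ⊥-elim (All.lookup x∉xs (∈-lookup j) eq)
lookup-injective {xs = _ ∷ _} (x∉xs ∷ _) {suc i} {zero}  eq = ⊥-elim (All.lookup x∉xs (∈-lookup i) (sym eq))
lookup-injective {xs = _ ∷ _} (_     ∷ u) {suc i} {suc j} eq = cong suc (lookup-injective u eq)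

n<m^n : ∀ {m} → 1 < m → ∀ n → n < m ^ n
n<m^n 1<m zero    = s≤s z≤n
n<m^n 1<m (suc n) = ≤-trans 2+n≤2*[1+n] (*-mono-≤ 1<m (n<m^n 1<m n))
  where
  2+n≤2*[1+n] : suc (suc n) ≤ 2 * suc n
  2+n≤2*[1+n] = s≤s (≤-trans (s≤s (m≤m+n n (n + 0))) (≤-reflexive (sym (+-suc n (n + 0)))))

∣m+[n∸o]⇒m%d≡o%d : ∀ {d} .{{_ : NonZero d}} m {n o} → o ≤ n → d ∣ n → d ∣ m + (n ∸ o) → m % d ≡ o % d
∣m+[n∸o]⇒m%d≡o%d {d} m {n} {o} o≤n d∣n d∣m+[n∸o] = begin
  m % d                 ≡⟨ %-remove-+ʳ m d∣n ⟨
  (m + n) % d           ≡⟨ cong (λ x → (m + x) % d) (m∸n+n≡m o≤n) ⟨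
  (m + (n ∸ o + o)) % d ≡⟨ cong (_% d) (+-assoc m (n ∸ o) o) ⟨
  (m + (n ∸ o) + o) % d ≡⟨ %-remove-+ˡ o d∣m+[n∸o] ⟩
  o % d                 ∎
  where open ≡-Reasoning

Separated : ∀ {n} (q : ℕ) → .{{NonZero q}} → List (Subset n) → Set
Separated q F = ∀ {A B} → A ∈ F → B ∈ F → A ≢ B → ¬ ModEq q ∣ A ∩ B ∣ ∣ A ∣

avoiding∧intersecting⇒separated : ∀ {n q} .{{_ : NonZero q}} {L} {F : List (Subset n)} →
                                  ModLAvoiding q L F → ModLIntersecting q L F → Separated q F
avoiding∧intersecting⇒separated avoiding intersecting {A} {B} A∈F B∈F A≢B ∩≡A =
  All.lookupWith (λ A≢ℓ ∩≡ℓ → A≢ℓ (trans (sym ∩≡A) ∩≡ℓ)) (avoiding A A∈F) (intersecting A B A∈F B∈F A≢B)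

module _ {p q′ : ℕ} (p-prime : Prime p) (k : ℕ) (q≡p^k : suc q′ ≡ p ^ k) (n : ℕ) where

  private
    q = suc q′
    instance
      p≢0 : NonZero p
      p≢0 = prime⇒nonZero p-prime
      p^n≢0 : NonZero (p ^ n)
      p^n≢0 = m^n≢0 p n

  Q : ℕ
  Q = q * p ^ n

  private instance
    Q≢0 : NonZero Q
    Q≢0 = m*n≢0 q (p ^ n)

  p^[k+n]≡Q : p ^ (k + n) ≡ Q
  p^[k+n]≡Q = trans (^-distribˡ-+-* p k n) (cong (_* p ^ n) (sym q≡p^k))

  ∣A∣<Q : (A : Subset n) → ∣ A ∣ < Q
  ∣A∣<Q A = ≤-<-trans (∣p∣≤n A) (<-≤-trans (n<m^n (nonTrivial⇒n>1 p {{prime⇒nonTrivial p-prime}}) n) (m≤n*m (p ^ n) q))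

  monomials : List (Subset n)
  monomials = concat (map (subsetsOfSize n) (upTo q))

  length-monomials : length monomials ≡ binomSumBelow n q
  length-monomials = trans (length-concat-map (subsetsOfSize n) (upTo q))
                           (sumMap-cong (upTo q) (λ j → trans (length-subsetsOfSize n j) (choose≡C n j)))

  -- The coefficient of x^t in the multilinear reduction of C(∑_{i ∈ A} x_i + Q − 1 − |A|, q − 1).
  coefficient : Subset n → Subset n → ℕ
  coefficient A t = [ t ⊆ A ] * choose (Q ∸ suc ∣ A ∣) (q′ ∸ ∣ t ∣)

  evaluate : Subset n → Subset n → ℕ
  evaluate A B = sumMap (λ t → coefficient A t * [ t ⊆ B ]) monomials

  evaluate≡choose : ∀ A B → evaluate A B ≡ choose (∣ A ∩ B ∣ + (Q ∸ suc ∣ A ∣)) q′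
  evaluate≡choose A B = begin
    evaluate A B                                                  ≡⟨ sumMap-concat g (subsetsOfSize n) (upTo q) ⟩
    sumMap (λ j → sumMap g (subsetsOfSize n j)) (upTo q)          ≡⟨ sumMap-cong (upTo q) sum-of-size ⟩
    sumMap (λ j → choose m j * choose c (q′ ∸ j)) (upTo q)        ≡⟨ convolution-upTo (choose m) (choose c) q′ ⟩
    convolution (choose m) (choose c) q′                          ≡⟨ vandermonde m c q′ ⟩
    choose (m + c) q′                                             ∎
    where
    open ≡-Reasoning
    m = ∣ A ∩ B ∣
    c = Q ∸ suc ∣ A ∣
    g = λ t → coefficient A t * [ t ⊆ B ]
    term : ∀ {j} t → ∣ t ∣ ≡ j → g t ≡ choose c (q′ ∸ j) * [ t ⊆ A ∩ B ]
    term t refl = trans (solve 3 (λ a c b → a :* c :* b := c :* (a :* b)) refl [ t ⊆ A ] (choose c (q′ ∸ ∣ t ∣)) [ t ⊆ B ])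
                        (cong (choose c (q′ ∸ ∣ t ∣) *_) ([⊆]-*-∩ t A B))
    sum-of-size : ∀ j → sumMap g (subsetsOfSize n j) ≡ choose m j * choose c (q′ ∸ j)
    sum-of-size j = begin
      sumMap g Sⱼ                                    ≡⟨ sumMap-congᴬ (∣∣-subsetsOfSize n j) (λ {t} → term t) ⟩
      sumMap (λ t → C * [ t ⊆ A ∩ B ]) Sⱼ            ≡⟨ sumMap-*ˡ C _ Sⱼ ⟩
      C * sumMap [_⊆ A ∩ B ] Sⱼ                      ≡⟨ cong (C *_) (sumMap-[⊆]-subsetsOfSize n j (A ∩ B)) ⟩
      C * choose m j                                 ≡⟨ *-comm C _ ⟩
      choose m j * C                                 ∎
      where
      Sⱼ = subsetsOfSize n j
      C = choose c (q′ ∸ j)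

  p∤evaluate-diagonal : ∀ A → ¬ p ∣ evaluate A A
  p∤evaluate-diagonal A =
    p∤choose[p^r-1] p-prime (k + n) (trans (suc-pred Q) (sym p^[k+n]≡Q)) q′ (pred-mono-≤ (m≤m*n q (p ^ n)))
    ∘ subst (p ∣_) (begin
        evaluate A A                           ≡⟨ evaluate≡choose A A ⟩
        choose (∣ A ∩ A ∣ + (Q ∸ suc a)) q′    ≡⟨ cong (λ X → choose (∣ X ∣ + (Q ∸ suc a)) q′) (∩-idem A) ⟩
        choose (a + (Q ∸ suc a)) q′            ≡⟨ cong (λ x → choose (pred x) q′) (m+[n∸m]≡n (∣A∣<Q A)) ⟩
        choose (pred Q) q′                     ∎)
    where
    open ≡-Reasoning
    a = ∣ A ∣

  p∣evaluate : ∀ A B → ¬ ModEq q ∣ A ∩ B ∣ ∣ A ∣ → p ∣ evaluate A B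
  p∣evaluate A B ∩≢A =
    subst (p ∣_) (sym (evaluate≡choose A B)) (p∣choose[m][p^k-1] p-prime k q≡p^k (x + (Q ∸ suc a)) q∤M+1)
    where
    x = ∣ A ∩ B ∣
    a = ∣ A ∣
    M+1≡ : suc (x + (Q ∸ suc a)) ≡ x + (Q ∸ a)
    M+1≡ = trans (sym (+-suc x _)) (cong (x +_) (sym (+-∸-assoc 1 (∣A∣<Q A))))
    q∤M+1 : ¬ q ∣ suc (x + (Q ∸ suc a))
    q∤M+1 q∣M+1 =
      ∩≢A (∣m+[n∸o]⇒m%d≡o%d x (<⇒≤ (∣A∣<Q A)) (divides (p ^ n) (*-comm q (p ^ n))) (subst (q ∣_) M+1≡ q∣M+1))

  separated⇒length≤monomials : (F : List (Subset n)) → Unique F → Separated q F → length F ≤ length monomials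
  separated⇒length≤monomials F F-unique separated = ≮⇒≥ no-relation
    where
    F[_] : Fin (length F) → Subset n
    F[ i ] = lookup F i
    no-relation : ¬ length monomials < length F
    no-relation |monomials|<|F| = proj₂ nontrivial (p∣coeff (proj₁ nontrivial))
      where
      open DependenceMod (length<⇒DependenceMod p-prime monomials |monomials|<|F| (λ i t → ℤ.+ coefficient F[ i ] t))
      term : Fin (length F) → Fin (length F) → ℤ.ℤ
      term j i = coeff i ℤ.* ℤ.+ evaluate F[ i ] F[ j ]
      p∣sum : ∀ j → ℤ.+ p ∣ᶻ sum (term j)
      p∣sum j = ∣-sum-weighted coeff (λ i → coefficient F[ i ]) [_⊆ F[ j ] ] monomials vanishes
      p∣off-diagonal : ∀ j i → i ≢ j → ℤ.+ p ∣ᶻ term j i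
      p∣off-diagonal j i i≢j = ∣n⇒∣m*n (coeff i) (∣ᵤ⇒∣ (p∣evaluate F[ i ] F[ j ]
        (separated (∈-lookup i) (∈-lookup j) (i≢j ∘ lookup-injective F-unique))))
      p∣coeff : ∀ j → ℤ.+ p ∣ᶻ coeff j
      p∣coeff j = [ id , ⊥-elim ∘ p∤evaluate-diagonal F[ j ] ∘ ∣⇒∣ᵤ ]′
        (+p∣m*n⇒+p∣m⊎+p∣n p-prime (coeff j) _ (∣-sum⇒∣-term (term j) j (p∣off-diagonal j) (p∣sum j)))

theorem6p3 : (n q : ℕ) → .{{_ : NonZero q}} → IsPrimePower q →
    (L : List ℕ) → Unique L → All (λ ℓ → ℓ < q) L →
    (F : List (Subset n)) → Unique F →
    ModLAvoiding q L F → ModLIntersecting q L F →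
    length F ≤ binomSumBelow n q
theorem6p3 n zero     _                               _ _ _ _ _ _ _ = ⊥-elim (≢-nonZero⁻¹ zero refl)
theorem6p3 n (suc q′) (p , k , p-prime , _ , q≡p^k) L _ _ F F-unique avoiding intersecting =
  subst (length F ≤_) (length-monomials p-prime k q≡p^k n)
        (separated⇒length≤monomials p-prime k q≡p^k n F F-unique (avoiding∧intersecting⇒separated avoiding intersecting))
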